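{- Let $T$ be an admissible triangle of order $n$ and $1\le d\le n-1$ such that row $d$ of $T$ is an $\mathcal{X}$-row and row $d-1$ is a $\mathcal{V}$-row. Then $R_d(T)$ is an admissible triangle.
   Context: Let $\mathcal{X}=\{x_i,y_i:1\le i\le n\}$ be formal symbols. For $1\le k\le n-1$, let $\mathcal{V}_k=\{a_{ij},b_{ij}:1\le i<j\le n,\ j-i=k\}$ be formal symbols. A triangle of order $n$ is an array with rows $1,\dots,n$, where row $r$ has $r$ entries at positions $1,\dots,r$. Row $n$ is $1,2,\dots,n$, and the entries of rows $1,\dots,n-1$ lie in $\mathcal{X}\cup\mathcal{V}_1\cup\dots\cup\mathcal{V}_{n-1}$. There is also a notional empty row $0$. A row $r\in\{1,\dots,n-1\}$ is an $\mathcal{X}$-row if all its entries lie in $\mathcal{X}$, and a $\mathcal{V}$-row if all its entries lie in a single $\mathcal{V}_k$; row $0$ counts as both. An arrangement is a triple $(u,v,w)$ such that, for some $2\le e\le n$ and $1\le p\le e-1$, $u$ and $w$ are the entries at positions $p$ and $p+1$ of row $e$ and $v$ is the entry at position $p$ of row $e-1$. An admissible ranking assigns a nonnegative integer rank to each row $0,\dots,n$ such that: - row $n$ has rank $0$ and row $n-1$ has rank $1$; - for each $1\le r\le n-1$, if row $r$ has rank $k$ then either row $r$ is an $\mathcal{X}$-row and row $r-1$ has rank $k$, or all entries of row $r$ lie in $\mathcal{V}_k$ and row $r-1$ has rank $k+1$. Such a ranking is unique if it exists; a triangle with one is called ranked. In a ranked triangle, an entry $u$ in a row of rank $t$ has a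 left value $l(u)$ and a right value $r(u)$: - for $u=a_{ij}$ or $b_{ij}$: $l=i$, $r=j$; - for $u=x_i$: $l=i$, $r=i+t$; - for $u=y_j$: $l=j-t$, $r=j$; - for the integer $u=i$ in row $n$: $l=r=i$. The triangle has the monotone diagonal property if every arrangement $(u,v,w)$ satisfies $l(u)\le l(v)$ and $r(v)\le r(w)$, together with $l(u)<l(v)$ whenever $u$ is some $y_j$ and $r(v)<r(w)$ whenever $w$ is some $x_j$. It has the monotone row property if every arrangement satisfies $l(u)<l(w)$. A triangle is admissible if it is ranked and has both properties. Raising operator $R_d$. Under the hypotheses of the claim, rows $d-1$ and $d$ have the same rank $t$. $R_d(T)$ is obtained from $T$ as follows; all other rows are unchanged. 1. For each position $p$: if row $d-1$ has $b_{jk}$ at position $p$ and row $d$ has $x_j$ at position $p$, exchange them, so that $x_j$ moves to position $p$ of row $d-1$ and $b_{jk}$ to position $p$ of row $d$. If row $d-1$ has $a_{jk}$ at position $p$ and row $d$ has $y_k$ at position $p+1$, move $y_k$ to position $p$ of row $d-1$ and $a_{jk}$ to position $p+1$ of row $d$. 2. Replace each remaining $a_{jk}$ in row $d-1$ by $x_j$ and each remaining $b_{jk}$ in row $d-1$ by $y_k$. Replace each remaining $x_i$ in row $d$ by $a_{i,i+t}$ and each remaining $y_j$ in row $d$ by $b_{j-t,j}$. -}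

module Defs where

open import Data.Nat using (ℕ; zero; suc; _+_; _∸_; _≤_; _<_; _≟_; _≤?_)
open import Data.Bool using (Bool; true; false; if_then_else_; _∧_)
open import Data.Product using (Σ; ∃; _×_)
open import Data.Sum using (_⊎_)
open import Data.Unit using (⊤)
open import Data.Empty using (⊥)
open import Relation.Nullary using (does)
open import Relation.Binary.PropositionalEquality using (_≡_)
import Data.Integer as ℤ
open ℤ using (ℤ; +_)

-- Symbols: x i, y i (the set 𝒳) and a i j, b i j (the sets 𝒱_k, k = j - i)

data Sym : Set where
  x y : ℕ → Sym
  a b : ℕ → ℕ → Sym

ValidSym : ℕ → Sym → Set
ValidSym n (x i)   = 1 ≤ i × i ≤ n
ValidSym n (y i)   = 1 ≤ i × i ≤ n
ValidSym n (a i j) = 1 ≤ i × i < j × j ≤ n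
ValidSym n (b i j) = 1 ≤ i × i < j × j ≤ n

-- A triangle is given by its entries in rows 1..n-1:  T r p  is the entry
-- at position p (1 ≤ p ≤ r) of row r.  Values outside this range are
-- irrelevant.  Row n (= 1,2,...,n) is fixed and handled by `entry`.
Triangle : Set
Triangle = ℕ → ℕ → Sym

IsTriangle : ℕ → Triangle → Set
IsTriangle n T = ∀ r p → 1 ≤ r → r < n → 1 ≤ p → p ≤ r → ValidSym n (T r p)

data Entry : Set where
  sym : Sym → Entry
  num : ℕ → Entry

entry : ℕ → Triangle → ℕ → ℕ → Entry
entry n T r p = if does (r ≟ n) then num p else sym (T r p)

IsX : Sym → Set
IsX (x _)   = ⊤
IsX (y _)   = ⊤
IsX (a _ _) = ⊥
IsX (b _ _) = ⊥

InV : ℕ → Sym → Set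
InV k (x _)   = ⊥
InV k (y _)   = ⊥
InV k (a i j) = i + k ≡ j
InV k (b i j) = i + k ≡ j

-- row r is an 𝒳-row (vacuous for row 0)
XRow : Triangle → ℕ → Set
XRow T r = ∀ p → 1 ≤ p → p ≤ r → IsX (T r p)

RowInV : Triangle → ℕ → ℕ → Set
RowInV T k r = ∀ p → 1 ≤ p → p ≤ r → InV k (T r p)

-- row r is a 𝒱-row (vacuous for row 0)
VRow : Triangle → ℕ → Set
VRow T r = ∃ λ k → RowInV T k r

-- Rankings (ρ r = rank of row r, for r = 0..n)

IsRanking : ℕ → Triangle → (ℕ → ℕ) → Set
IsRanking n T ρ =
  ρ n ≡ 0 × ρ (n ∸ 1) ≡ 1 ×
  (∀ r → 1 ≤ r → r < n →
     (XRow T r × ρ (r ∸ 1) ≡ ρ r) ⊎ (RowInV T (ρ r) r × ρ (r ∸ 1) ≡ suc (ρ r)))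

-- left and right values of an entry in a row of rank t
lval : ℕ → Entry → ℤ
lval t (sym (x i))   = + i
lval t (sym (y j))   = + j ℤ.- + t
lval t (sym (a i j)) = + i
lval t (sym (b i j)) = + i
lval t (num i)       = + i

rval : ℕ → Entry → ℤ
rval t (sym (x i))   = + (i + t)
rval t (sym (y j))   = + j
rval t (sym (a i j)) = + j
rval t (sym (b i j)) = + j
rval t (num i)       = + i

IsXE : Entry → Set
IsXE (sym (x _)) = ⊤
IsXE _           = ⊥

IsYE : Entry → Set
IsYE (sym (y _)) = ⊤
IsYE _           = ⊥

MonotoneDiagonal : ℕ → Triangle → (ℕ → ℕ) → Set
MonotoneDiagonal n T ρ =
  ∀ e p → 2 ≤ e → e ≤ n → 1 ≤ p → p < e →
    let u = entry n T e p
        v = entry n T (e ∸ 1) p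
        w = entry n T e (suc p)
        te = ρ e
        tv = ρ (e ∸ 1)
    in (lval te u ℤ.≤ lval tv v) × (rval tv v ℤ.≤ rval te w) ×
       (IsYE u → lval te u ℤ.< lval tv v) × (IsXE w → rval tv v ℤ.< rval te w)

MonotoneRow : ℕ → Triangle → (ℕ → ℕ) → Set
MonotoneRow n T ρ =
  ∀ e p → 2 ≤ e → e ≤ n → 1 ≤ p → p < e →
    lval (ρ e) (entry n T e p) ℤ.< lval (ρ e) (entry n T e (suc p))

AdmissibleWith : ℕ → Triangle → (ℕ → ℕ) → Set
AdmissibleWith n T ρ = IsRanking n T ρ × MonotoneDiagonal n T ρ × MonotoneRow n T ρ

Admissible : ℕ → Triangle → Set
Admissible n T = IsTriangle n T × Σ (ℕ → ℕ) (AdmissibleWith n T)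

-- The raising operator R_d (t = common rank of rows d-1 and d)

isXj : ℕ → Sym → Bool
isXj j (x i) = does (i ≟ j)
isXj j _     = false

isYk : ℕ → Sym → Bool
isYk k (y i) = does (i ≟ k)
isYk k _     = false

isB-first : ℕ → Sym → Bool
isB-first i (b j k) = does (j ≟ i)
isB-first i _       = false

isA-second : ℕ → Sym → Bool
isA-second k (a i j) = does (j ≟ k)
isA-second k _       = false

raiseTop : ℕ → Triangle → ℕ → Sym
raiseTop d T p with T (d ∸ 1) p
... | a j k = if isYk k (T d (suc p)) then y k else x j
... | b j k = if isXj j (T d p) then x j else y k
... | s     = s

raiseBot : ℕ → ℕ → Triangle → ℕ → Sym
raiseBot d t T q with T d q
... | x i = if does (q ≤? d ∸ 1) ∧ isB-first i (T (d ∸ 1) q)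
              then T (d ∸ 1) q else a i (i + t)
... | y j = if does (2 ≤? q) ∧ isA-second j (T (d ∸ 1) (q ∸ 1))
              then T (d ∸ 1) (q ∸ 1) else b (j ∸ t) j
... | s   = s

raise : ℕ → ℕ → Triangle → Triangle
raise d t T r p =
  if does (r ≟ d) then raiseBot d t T p
  else if does (r ≟ d ∸ 1) then raiseTop d T p
  else T r p

{-# OPTIONS --safe #-}
-- Rows d - 1 and d of T have a common rank t. The diagonal property propagates the values
-- 1, …, n of row n upwards, so the entry at position q of row d spans an interval
-- [c_q, c_q + t] inside [1, n] and the entry at position p of row d - 1 an interval
-- [j_p, j_p + t]; moreover c_p ≤ j_p ≤ c_{p+1}, strictly on the left if row d has a y at p and
-- on the right if it has an x at p + 1, and c_p < c_{p+1} by the row property. R_d turns row d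
-- into a 𝒱_t-row spanning the same intervals, and puts at position p of row d - 1, now of
-- rank t + 1, either x_{j_p}, spanning [j_p, j_p + t + 1], with j_p < c_{p+1}, or y_{j_p + t},
-- spanning [j_p - 1, j_p + t], with c_p < j_p. These inequalities are exactly what the
-- monotone diagonal and row properties of R_d(T) ask for; all other rows keep entries and ranks.
module Submission where

open import Defs
open import Data.Nat using (ℕ; _≤_; _<_; _∸_)
open import Data.Nat using (zero; suc; _+_; z≤n; s≤s; s≤s⁻¹; _≟_; _≤ᵇ_; _≡ᵇ_)
import Data.Nat.Properties as ℕ
import Data.Integer as ℤ
open ℤ using (+_; +≤+; +<+)
import Data.Integer.Properties as ℤₚ
open import Data.Bool using (true; false; if_then_else_)
open import Data.Product using (_×_; _,_; proj₁; proj₂)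
open import Data.Sum using (_⊎_; inj₁; inj₂)
open import Data.Unit using (tt)
open import Data.Empty using (⊥-elim)
open import Function using (_∘_)
open import Relation.Nullary using (yes; no; does; ¬_)
open import Relation.Nullary.Decidable using (dec-true; dec-false)
open import Relation.Nullary.Reflects using (Reflects; ofʸ; ofⁿ; fromEquivalence)
open import Relation.Binary.PropositionalEquality
  using (_≡_; _≢_; refl; trans; cong; cong₂; subst; subst₂; ≢-sym) renaming (sym to ≡-sym)

pred-< : ∀ {m} → 1 ≤ m → m ∸ 1 < m
pred-< {suc m} _ = ℕ.n<1+n m

pred-≢ : ∀ {m k} → 1 ≤ m → m ≢ suc k → m ∸ 1 ≢ k
pred-≢ {suc m} _ m≢k eq = m≢k (cong suc eq)

-- does (m ≟ n) normalises to m ≡ᵇ n, the term that with-abstraction must match in raiseBot/raiseTop.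
≡ᵇ-reflects-≡ : ∀ m n → Reflects (m ≡ n) (m ≡ᵇ n)
≡ᵇ-reflects-≡ m n = fromEquivalence (ℕ.≡ᵇ⇒≡ m n) (ℕ.≡⇒≡ᵇ m n)

DiagonalAt : ℕ → Entry → ℕ → Entry → Entry → Set
DiagonalAt tᵤ u tᵥ v w =
  (lval tᵤ u ℤ.≤ lval tᵥ v) × (rval tᵥ v ℤ.≤ rval tᵤ w) ×
  (IsYE u → lval tᵤ u ℤ.< lval tᵥ v) × (IsXE w → rval tᵥ v ℤ.< rval tᵤ w)

DiagonalAt-transport : ∀ {tᵤ tᵤ′ tᵥ tᵥ′ u u′ v v′ w w′} →
  tᵤ ≡ tᵤ′ → u ≡ u′ → w ≡ w′ → lval tᵥ v ≡ lval tᵥ′ v′ → rval tᵥ v ≡ rval tᵥ′ v′ →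
  DiagonalAt tᵤ u tᵥ v w → DiagonalAt tᵤ′ u′ tᵥ′ v′ w′
DiagonalAt-transport refl refl refl l≡ r≡ (l≤ , r≤ , l< , r<) =
  subst (_ ℤ.≤_) l≡ l≤ , subst (ℤ._≤ _) r≡ r≤ , subst (_ ℤ.<_) l≡ ∘ l< , subst (ℤ._< _) r≡ ∘ r<

RankStep : Triangle → (ℕ → ℕ) → ℕ → Set
RankStep T ρ r =
  (XRow T r × ρ (r ∸ 1) ≡ ρ r) ⊎ (RowInV T (ρ r) r × ρ (r ∸ 1) ≡ suc (ρ r))

entry-at-n : ∀ {n T p} → entry n T n p ≡ num p
entry-at-n {n} rewrite dec-true (n ≟ n) refl = refl

entry-below : ∀ {n T r p} → r < n → entry n T r p ≡ sym (T r p)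
entry-below {n} {r = r} r<n rewrite dec-false (r ≟ n) (ℕ.<⇒≢ r<n) = refl

entry-cong : ∀ {n T T′ r p} → T r p ≡ T′ r p → entry n T r p ≡ entry n T′ r p
entry-cong {n} {r = r} {p} = cong (λ s → if does (r ≟ n) then num p else sym s)

raise-bottom : ∀ {d t T q} → raise d t T d q ≡ raiseBot d t T q
raise-bottom {d} rewrite dec-true (d ≟ d) refl = refl

raise-top : ∀ {d t T p} → raise (suc d) t T d p ≡ raiseTop (suc d) T p
raise-top {d} rewrite dec-false (d ≟ suc d) (≢-sym ℕ.1+n≢n) | dec-true (d ≟ d) refl = refl

raise-other : ∀ {d t T r p} → r ≢ d → r ≢ d ∸ 1 → raise d t T r p ≡ T r p
raise-other {d} {r = r} r≢d r≢d-1
  rewrite dec-false (r ≟ d) r≢d | dec-false (r ≟ d ∸ 1) r≢d-1 = refl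

IsX⇒¬InV : ∀ {k s} → IsX s → ¬ InV k s
IsX⇒¬InV {s = x _} _ ()
IsX⇒¬InV {s = y _} _ ()

XRow⇒¬RowInV : ∀ {T r k} → 1 ≤ r → XRow T r → ¬ RowInV T k r
XRow⇒¬RowInV 1≤r isX inV = IsX⇒¬InV (isX 1 ℕ.≤-refl 1≤r) (inV 1 ℕ.≤-refl 1≤r)

module Admissibility {n : ℕ} {T : Triangle} {ρ : ℕ → ℕ} where

  rank-positive : IsRanking n T ρ → ∀ {r} → r < n → 1 ≤ ρ r
  rank-positive (_ , ρ[n-1]≡1 , step) {r} r<n = go (n ∸ suc r) (ℕ.m+[n∸m]≡n r<n)
    where
    go : ∀ k {r} → suc r + k ≡ n → 1 ≤ ρ r
    go zero {r} eq =
      subst (λ m → 1 ≤ ρ m) (trans (cong (_∸ 1) (≡-sym eq)) (ℕ.+-identityʳ r))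
        (ℕ.≤-reflexive (≡-sym ρ[n-1]≡1))
    go (suc k) {r} eq with step (suc r) (s≤s z≤n) (subst (suc r <_) eq (ℕ.m<m+n (suc r) (s≤s z≤n)))
    ... | inj₁ (_ , ρr≡) = subst (1 ≤_) (≡-sym ρr≡) (go k (trans (≡-sym (ℕ.+-suc (suc r) k)) eq))
    ... | inj₂ (_ , ρr≡) = subst (1 ≤_) (≡-sym ρr≡) (s≤s z≤n)

  entry-in-cone : MonotoneDiagonal n T ρ → ∀ k {r p} → r + k ≡ n → 1 ≤ p → p ≤ r →
    + p ℤ.≤ lval (ρ r) (entry n T r p) × rval (ρ r) (entry n T r p) ℤ.≤ + (p + k)
  entry-in-cone diagonal zero {r} {p} eq _ _ with trans (≡-sym (ℕ.+-identityʳ r)) eq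
  ... | refl rewrite entry-at-n {n} {T} {p} = ℤₚ.≤-refl , +≤+ (ℕ.m≤m+n p 0)
  entry-in-cone diagonal (suc k) {r} {p} eq 1≤p p≤r =
    ℤₚ.≤-trans (proj₁ (entry-in-cone diagonal k eq′ 1≤p (ℕ.m≤n⇒m≤1+n p≤r))) (proj₁ arrangement) ,
    ℤₚ.≤-trans (proj₁ (proj₂ arrangement))
      (subst (λ m → rval (ρ (suc r)) (entry n T (suc r) (suc p)) ℤ.≤ + m) (≡-sym (ℕ.+-suc p k))
        (proj₂ (entry-in-cone diagonal k eq′ (s≤s z≤n) (s≤s p≤r))))
    where
    eq′ : suc r + k ≡ n
    eq′ = trans (≡-sym (ℕ.+-suc r k)) eq
    arrangement : DiagonalAt (ρ (suc r)) (entry n T (suc r) p) (ρ r) (entry n T r p)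
                             (entry n T (suc r) (suc p))
    arrangement = diagonal (suc r) p (s≤s (ℕ.≤-trans 1≤p p≤r))
                    (subst (suc r ≤_) eq′ (ℕ.m≤m+n (suc r) k)) 1≤p (s≤s p≤r)

  within-bounds : MonotoneDiagonal n T ρ → ∀ {r p} → r < n → 1 ≤ p → p ≤ r →
    + 1 ℤ.≤ lval (ρ r) (sym (T r p)) × rval (ρ r) (sym (T r p)) ℤ.≤ + n
  within-bounds diagonal {r} {p} r<n 1≤p p≤r =
    subst (λ u → + 1 ℤ.≤ lval (ρ r) u × rval (ρ r) u ℤ.≤ + n) (entry-below {n} {T} {r} {p} r<n)
      (ℤₚ.≤-trans (+≤+ 1≤p) (proj₁ cone) ,
       ℤₚ.≤-trans (proj₂ cone) (+≤+ (subst (p + (n ∸ r) ≤_) r+k≡n (ℕ.+-monoˡ-≤ (n ∸ r) p≤r))))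
    where
    r+k≡n : r + (n ∸ r) ≡ n
    r+k≡n = ℕ.m+[n∸m]≡n (ℕ.<⇒≤ r<n)
    cone : + p ℤ.≤ lval (ρ r) (entry n T r p) × rval (ρ r) (entry n T r p) ℤ.≤ + (p + (n ∸ r))
    cone = entry-in-cone diagonal (n ∸ r) r+k≡n 1≤p p≤r

  diagonal-below : MonotoneDiagonal n T ρ → ∀ {e p} → e < n → 2 ≤ e → 1 ≤ p → p < e →
    DiagonalAt (ρ e) (sym (T e p)) (ρ (e ∸ 1)) (sym (T (e ∸ 1) p)) (sym (T e (suc p)))
  diagonal-below diagonal {e} {p} e<n 2≤e 1≤p p<e =
    DiagonalAt-transport refl (entry-below {T = T} e<n) (entry-below {T = T} e<n)
      (cong (lval _) (entry-below {T = T} e-1<n)) (cong (rval _) (entry-below {T = T} e-1<n))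
      (diagonal e p 2≤e (ℕ.<⇒≤ e<n) 1≤p p<e)
    where
    e-1<n : e ∸ 1 < n
    e-1<n = ℕ.≤-<-trans (ℕ.m∸n≤m e 1) e<n

  row-below : MonotoneRow n T ρ → ∀ {e p} → e < n → 2 ≤ e → 1 ≤ p → p < e →
    lval (ρ e) (sym (T e p)) ℤ.< lval (ρ e) (sym (T e (suc p)))
  row-below row e<n 2≤e 1≤p p<e =
    subst₂ (λ u w → lval _ u ℤ.< lval _ w) (entry-below {T = T} e<n) (entry-below {T = T} e<n)
      (row _ _ 2≤e (ℕ.<⇒≤ e<n) 1≤p p<e)

-- Both kinds describe an entry of left value c and right value c + t in a row of rank t.
data XShape (t c : ℕ) : Sym → Set where
  x-shape : XShape t c (x c)
  y-shape : XShape t c (y (c + t))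

data VShape (t c : ℕ) : Sym → Set where
  a-shape : VShape t c (a c (c + t))
  b-shape : VShape t c (b c (c + t))

-- The new entry at position p of row d - 1 under R_d, where c₀ and c₁ are the left values at
-- positions p and p + 1 of row d, and j is the left value at position p of row d - 1.
data RaisedShape (t c₀ j c₁ : ℕ) : Sym → Set where
  x-raised : c₀ ≤ j → j < c₁ → RaisedShape t c₀ j c₁ (x j)
  y-raised : c₀ < j → j ≤ c₁ → RaisedShape t c₀ j c₁ (y (j + t))

-- For y j with j < t the truncated subtraction gives junk; IsX⇒XShape excludes that case.
lvalℕ : ℕ → Sym → ℕ
lvalℕ t (x i)   = i
lvalℕ t (y j)   = j ∸ t
lvalℕ t (a i _) = i
lvalℕ t (b i _) = i

lval-y : ∀ t c → lval t (sym (y (c + t))) ≡ + c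
lval-y t c = trans (ℤₚ.m-n≡m⊖n (c + t) t) (trans (ℤₚ.⊖-≥ (ℕ.m≤n+m t c)) (cong +_ (ℕ.m+n∸n≡m c t)))

lval-raised-y : ∀ t m → lval (suc t) (sym (y (suc m + t))) ≡ + m
lval-raised-y t m =
  trans (cong (λ k → lval (suc t) (sym (y k))) (≡-sym (ℕ.+-suc m t))) (lval-y (suc t) m)

module _ {t c : ℕ} {s : Sym} where

  XShape-lval : XShape t c s → lval t (sym s) ≡ + c
  XShape-lval x-shape = refl
  XShape-lval y-shape = lval-y t c

  XShape-rval : XShape t c s → rval t (sym s) ≡ + (c + t)
  XShape-rval x-shape = refl
  XShape-rval y-shape = refl

  VShape-lval : ∀ {r} → VShape t c s → lval r (sym s) ≡ + c
  VShape-lval a-shape = refl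
  VShape-lval b-shape = refl

  VShape-rval : ∀ {r} → VShape t c s → rval r (sym s) ≡ + (c + t)
  VShape-rval a-shape = refl
  VShape-rval b-shape = refl

  VShape-¬IsXE : VShape t c s → ¬ IsXE (sym s)
  VShape-¬IsXE a-shape ()
  VShape-¬IsXE b-shape ()

  VShape-¬IsYE : VShape t c s → ¬ IsYE (sym s)
  VShape-¬IsYE a-shape ()
  VShape-¬IsYE b-shape ()

  VShape-InV : VShape t c s → InV t s
  VShape-InV a-shape = refl
  VShape-InV b-shape = refl

  VShape-valid : ∀ {n} → 1 ≤ t → VShape t c s → 1 ≤ c × c + t ≤ n → ValidSym n s
  VShape-valid 1≤t a-shape (1≤c , c+t≤n) = 1≤c , ℕ.m<m+n c 1≤t , c+t≤n
  VShape-valid 1≤t b-shape (1≤c , c+t≤n) = 1≤c , ℕ.m<m+n c 1≤t , c+t≤n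

  span-bounds : ∀ {r n} → lval r (sym s) ≡ + c → rval r (sym s) ≡ + (c + t) →
    + 1 ℤ.≤ lval r (sym s) × rval r (sym s) ℤ.≤ + n → 1 ≤ c × c + t ≤ n
  span-bounds {n = n} l≡ r≡ (1≤l , r≤n) =
    ℤₚ.drop‿+≤+ (subst (+ 1 ℤ.≤_) l≡ 1≤l) , ℤₚ.drop‿+≤+ (subst (ℤ._≤ + n) r≡ r≤n)

IsX⇒XShape : ∀ {t s} → IsX s → + 0 ℤ.≤ lval t (sym s) → XShape t (lvalℕ t s) s
IsX⇒XShape {s = x i} _ _ = x-shape
IsX⇒XShape {t} {y m} _ 0≤l =
  subst (XShape t (m ∸ t) ∘ y) (ℕ.m∸n+n≡m {m} {t} (ℤₚ.drop‿+≤+ (ℤₚ.0≤i-j⇒j≤i {+ m} {+ t} 0≤l)))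
    y-shape

InV⇒VShape : ∀ {t s} → InV t s → VShape t (lvalℕ t s) s
InV⇒VShape {s = x _} ()
InV⇒VShape {s = y _} ()
InV⇒VShape {s = a _ _} refl = a-shape
InV⇒VShape {s = b _ _} refl = b-shape

b-shape-∸ : ∀ {t c} → VShape t c (b (c + t ∸ t) (c + t))
b-shape-∸ {t} {c} = subst (λ i → VShape t c (b i (c + t))) (≡-sym (ℕ.m+n∸n≡m c t)) b-shape

module _ {t c₀ c₁ : ℕ} {s : Sym} where

  RaisedShape-IsX : ∀ {j} → RaisedShape t c₀ j c₁ s → IsX s
  RaisedShape-IsX (x-raised _ _) = tt
  RaisedShape-IsX (y-raised _ _) = tt

  RaisedShape-valid : ∀ {j n} → RaisedShape t c₀ j c₁ s → 1 ≤ j × j + t ≤ n → ValidSym n s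
  RaisedShape-valid {j} (x-raised _ _) (1≤j , j+t≤n) = 1≤j , ℕ.≤-trans (ℕ.m≤m+n j t) j+t≤n
  RaisedShape-valid {j} (y-raised _ _) (1≤j , j+t≤n) = ℕ.≤-trans 1≤j (ℕ.m≤m+n j t) , j+t≤n

  RaisedShape-lval-≥ : ∀ {j} → RaisedShape t c₀ j c₁ s → + c₀ ℤ.≤ lval (suc t) (sym s)
  RaisedShape-lval-≥ (x-raised c₀≤j _) = +≤+ c₀≤j
  RaisedShape-lval-≥ {suc m} (y-raised (s≤s c₀≤m) _) =
    subst (+ c₀ ℤ.≤_) (≡-sym (lval-raised-y t m)) (+≤+ c₀≤m)

  RaisedShape-lval-≤ : ∀ {j} → RaisedShape t c₀ j c₁ s →
    lval (suc t) (sym s) ℤ.≤ + j × (IsYE (sym s) → lval (suc t) (sym s) ℤ.< + j)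
  RaisedShape-lval-≤ (x-raised _ _) = ℤₚ.≤-refl , λ ()
  RaisedShape-lval-≤ {suc m} (y-raised _ _) rewrite lval-raised-y t m =
    ℤₚ.<⇒≤ m<1+m , λ _ → m<1+m
    where
    m<1+m : + m ℤ.< + suc m
    m<1+m = +<+ (ℕ.n<1+n m)

  RaisedShape-rval-≤ : ∀ {j} → RaisedShape t c₀ j c₁ s → rval (suc t) (sym s) ℤ.≤ + (c₁ + t)
  RaisedShape-rval-≤ {j} (x-raised _ j<c₁) =
    +≤+ (subst (_≤ c₁ + t) (≡-sym (ℕ.+-suc j t)) (ℕ.+-monoˡ-≤ t j<c₁))
  RaisedShape-rval-≤ (y-raised _ j≤c₁) = +≤+ (ℕ.+-monoˡ-≤ t j≤c₁)

  RaisedShape-rval-≥ : ∀ {j} → RaisedShape t c₀ j c₁ s →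
    + (j + t) ℤ.≤ rval (suc t) (sym s) × (IsXE (sym s) → + (j + t) ℤ.< rval (suc t) (sym s))
  RaisedShape-rval-≥ {j} (x-raised _ _) = ℤₚ.<⇒≤ j+t<j+1+t , λ _ → j+t<j+1+t
    where
    j+t<j+1+t : + (j + t) ℤ.< + (j + suc t)
    j+t<j+1+t = +<+ (ℕ.+-monoʳ-< j (ℕ.n<1+n t))
  RaisedShape-rval-≥ (y-raised _ _) = ℤₚ.≤-refl , λ ()

record Interlacing (c₀ j c₁ : ℕ) (u w : Sym) : Set where
  field
    left         : c₀ ≤ j
    right        : j ≤ c₁
    left-strict  : IsYE (sym u) → c₀ < j
    right-strict : IsXE (sym w) → j < c₁
    increasing   : c₀ < c₁

open Interlacing

arrangement⇒Interlacing : ∀ {t t′ c₀ j c₁ u v w} →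
  XShape t c₀ u → VShape t j v → XShape t c₁ w →
  DiagonalAt t (sym u) t′ (sym v) (sym w) → lval t (sym u) ℤ.< lval t (sym w) →
  Interlacing c₀ j c₁ u w
arrangement⇒Interlacing {t} su sv sw (l≤ , r≤ , l< , r<) u<w = record
  { left         = ℤₚ.drop‿+≤+ (subst₂ ℤ._≤_ (XShape-lval su) (VShape-lval sv) l≤)
  ; right        = ℕ.+-cancelʳ-≤ t _ _ (ℤₚ.drop‿+≤+ (subst₂ ℤ._≤_ (VShape-rval sv) (XShape-rval sw) r≤))
  ; left-strict  = ℤₚ.drop‿+<+ ∘ subst₂ ℤ._<_ (XShape-lval su) (VShape-lval sv) ∘ l<
  ; right-strict = ℕ.+-cancelʳ-< t _ _ ∘ ℤₚ.drop‿+<+ ∘ subst₂ ℤ._<_ (VShape-rval sv) (XShape-rval sw) ∘ r<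
  ; increasing   = ℤₚ.drop‿+<+ (subst₂ ℤ._<_ (XShape-lval su) (XShape-lval sw) u<w)
  }

-- Row d - 1 lies in 𝒱_t, so an entry exchanged with x_c or y_{c+t} is a_{c,c+t} or b_{c,c+t}.
raiseBot-shape : ∀ {d t T q c} → RowInV T t (d ∸ 1) → 1 ≤ q → q ≤ d →
  XShape t c (T d q) → VShape t c (raiseBot d t T q)
raiseBot-shape {d} {t} {T} {q} {c} above 1≤q q≤d shape with T d q | shape
... | _ | x-shape with q ≤ᵇ d ∸ 1 | ℕ.≤ᵇ-reflects-≤ q (d ∸ 1)
...   | false | _ = a-shape
...   | true | ofʸ q≤d-1 with T (d ∸ 1) q | above q 1≤q q≤d-1
...     | a _ _ | _ = a-shape
...     | b i _ | refl with i ≡ᵇ c | ≡ᵇ-reflects-≡ i c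
...       | true | ofʸ refl = b-shape
...       | false | _ = a-shape
raiseBot-shape {d} {t} {T} {q} {c} above 1≤q q≤d shape | _ | y-shape
  with 2 ≤ᵇ q | ℕ.≤ᵇ-reflects-≤ 2 q
...   | false | _ = b-shape-∸
...   | true | ofʸ 2≤q with T (d ∸ 1) (q ∸ 1) | above (q ∸ 1) (ℕ.∸-monoˡ-≤ 1 2≤q) (ℕ.∸-monoˡ-≤ 1 q≤d)
...     | b _ _ | _ = b-shape-∸
...     | a i _ | refl with i + t ≡ᵇ c + t | ≡ᵇ-reflects-≡ (i + t) (c + t)
...       | true | ofʸ i+t≡c+t =
  subst (λ i → VShape t c (a i (i + t))) (≡-sym (ℕ.+-cancelʳ-≡ t i c i+t≡c+t)) a-shape
...       | false | _ = b-shape-∸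

-- If an exchange takes place (c₀ = j or c₁ = j), the strict bound comes from the row property c₀ < c₁.
raiseTop-shape : ∀ {d t T p c₀ j c₁} →
  XShape t c₀ (T d p) → VShape t j (T (d ∸ 1) p) → XShape t c₁ (T d (suc p)) →
  Interlacing c₀ j c₁ (T d p) (T d (suc p)) → RaisedShape t c₀ j c₁ (raiseTop d T p)
raiseTop-shape {d} {t} {T} {p} {c₀} {j} {c₁} su sv sw il with T (d ∸ 1) p | sv
... | _ | a-shape with T d (suc p) | sw | il
...   | _ | x-shape | il′ = x-raised (left il′) (right-strict il′ tt)
...   | _ | y-shape | il′ with c₁ + t ≡ᵇ j + t | ≡ᵇ-reflects-≡ (c₁ + t) (j + t)
...     | true | ofʸ eq = y-raised (subst (c₀ <_) (ℕ.+-cancelʳ-≡ t c₁ j eq) (increasing il′)) (right il′)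
...     | false | ofⁿ ne = x-raised (left il′) (ℕ.≤∧≢⇒< (right il′) (ne ∘ cong (_+ t) ∘ ≡-sym))
raiseTop-shape {d} {t} {T} {p} {c₀} {j} {c₁} su sv sw il | _ | b-shape with T d p | su | il
...   | _ | y-shape | il′ = y-raised (left-strict il′ tt) (right il′)
...   | _ | x-shape | il′ with c₀ ≡ᵇ j | ≡ᵇ-reflects-≡ c₀ j
...     | true | ofʸ refl = x-raised ℕ.≤-refl (increasing il′)
...     | false | ofⁿ c₀≢j = y-raised (ℕ.≤∧≢⇒< (left il′) c₀≢j) (right il′)

raised-lower-diagonal : ∀ {t c₀ j c₁ u v w} →
  VShape t c₀ u → RaisedShape t c₀ j c₁ v → VShape t c₁ w → DiagonalAt t (sym u) (suc t) (sym v) (sym w)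
raised-lower-diagonal su sv sw =
  subst (ℤ._≤ _) (≡-sym (VShape-lval su)) (RaisedShape-lval-≥ sv) ,
  subst (_ ℤ.≤_) (≡-sym (VShape-rval sw)) (RaisedShape-rval-≤ sv) ,
  ⊥-elim ∘ VShape-¬IsYE su , ⊥-elim ∘ VShape-¬IsXE sw

raised-upper-diagonal : ∀ {t t′ c₀ j₀ c₁ j₁ c₂ u v w} →
  RaisedShape t c₀ j₀ c₁ u → RaisedShape t c₁ j₁ c₂ w →
  + j₀ ℤ.≤ lval t′ v → rval t′ v ℤ.≤ + (j₁ + t) → DiagonalAt (suc t) (sym u) t′ v (sym w)
raised-upper-diagonal su sw j₀≤l r≤j₁+t with RaisedShape-lval-≤ su | RaisedShape-rval-≥ sw
... | u≤j₀ , u<j₀ | j₁+t≤w , j₁+t<w =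
  ℤₚ.≤-trans u≤j₀ j₀≤l , ℤₚ.≤-trans r≤j₁+t j₁+t≤w ,
  (λ isY → ℤₚ.<-≤-trans (u<j₀ isY) j₀≤l) , (λ isX → ℤₚ.≤-<-trans r≤j₁+t (j₁+t<w isX))

raised-row : ∀ {t c₀ j₀ c₁ j₁ c₂ u w} →
  RaisedShape t c₀ j₀ c₁ u → RaisedShape t c₁ j₁ c₂ w → j₀ < j₁ →
  lval (suc t) (sym u) ℤ.< lval (suc t) (sym w)
raised-row (x-raised _ _) (x-raised _ _) j₀<j₁ = +<+ j₀<j₁
raised-row {t} {j₀ = j₀} {j₁ = suc m₁} (x-raised _ j₀<c₁) (y-raised (s≤s c₁≤m₁) _) _ =
  subst (+ j₀ ℤ.<_) (≡-sym (lval-raised-y t m₁)) (+<+ (ℕ.<-≤-trans j₀<c₁ c₁≤m₁))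
raised-row {t} {j₀ = suc m₀} (y-raised _ _) (x-raised _ _) j₀<j₁ =
  subst (ℤ._< _) (≡-sym (lval-raised-y t m₀)) (+<+ (ℕ.<-trans (ℕ.n<1+n m₀) j₀<j₁))
raised-row {t} {j₀ = suc m₀} {j₁ = suc m₁} (y-raised _ _) (y-raised _ _) (s≤s m₀<m₁) =
  subst₂ ℤ._<_ (≡-sym (lval-raised-y t m₀)) (≡-sym (lval-raised-y t m₁)) (+<+ m₀<m₁)

-- Here row suc d is the 𝒳-row (the d of R_d) and row d the 𝒱-row above it.
module Raise {n : ℕ} {T : Triangle} {ρ : ℕ → ℕ} {d : ℕ}
  (triangle : IsTriangle n T) (ranked : IsRanking n T ρ)
  (diagonal : MonotoneDiagonal n T ρ) (row : MonotoneRow n T ρ)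
  (d+1<n : suc d < n) (X-row : XRow T (suc d)) (V-row : VRow T d) where

  open Admissibility {n} {T} {ρ}

  t : ℕ
  t = ρ (suc d)

  T′ : Triangle
  T′ = raise (suc d) t T

  ρ′ : ℕ → ℕ
  ρ′ r = if does (r ≟ d) then suc t else ρ r

  d<n : d < n
  d<n = ℕ.<-trans (ℕ.n<1+n d) d+1<n

  rank-step : ∀ r → 1 ≤ r → r < n → RankStep T ρ r
  rank-step = proj₂ (proj₂ ranked)

  ρd≡t : ρ d ≡ t
  ρd≡t with rank-step (suc d) (s≤s z≤n) d+1<n
  ... | inj₁ (_ , ρd≡t) = ρd≡t
  ... | inj₂ (inV , _) = ⊥-elim (XRow⇒¬RowInV {T} (s≤s z≤n) X-row inV)

  upper-rank : 1 ≤ d → RowInV T t d × ρ (d ∸ 1) ≡ suc t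
  upper-rank 1≤d with rank-step d 1≤d d<n
  ... | inj₁ (isX , _) = ⊥-elim (XRow⇒¬RowInV {T} 1≤d isX (proj₂ V-row))
  ... | inj₂ (inV , eq) = subst (λ k → RowInV T k d) ρd≡t inV , trans eq (cong suc ρd≡t)

  upper-in-V : RowInV T t d
  upper-in-V p 1≤p p≤d = proj₁ (upper-rank (ℕ.≤-trans 1≤p p≤d)) p 1≤p p≤d

  ρ′-upper : ρ′ d ≡ suc t
  ρ′-upper rewrite dec-true (d ≟ d) refl = refl

  ρ′-other : ∀ {r} → r ≢ d → ρ′ r ≡ ρ r
  ρ′-other {r} r≢d rewrite dec-false (r ≟ d) r≢d = refl

  ρ′-lower : ρ′ (suc d) ≡ t
  ρ′-lower = ρ′-other ℕ.1+n≢n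

  T′-other : ∀ {r p} → r ≢ suc d → r ≢ d → T′ r p ≡ T r p
  T′-other {r} {p} = raise-other {suc d} {t} {T} {r} {p}

  entry-other : ∀ {r p} → r ≢ suc d → r ≢ d → entry n T r p ≡ entry n T′ r p
  entry-other {r} {p} r≢d+1 r≢d = entry-cong {n} {T} {T′} {r} {p} (≡-sym (T′-other r≢d+1 r≢d))

  entry-lower : ∀ {T″ q} → entry n T″ (suc d) q ≡ sym (T″ (suc d) q)
  entry-lower {T″} {q} = entry-below {n} {T″} {suc d} {q} d+1<n

  entry-upper : ∀ {T″ p} → entry n T″ d p ≡ sym (T″ d p)
  entry-upper {T″} {p} = entry-below {n} {T″} {d} {p} d<n

  c : ℕ → ℕ
  c q = lvalℕ t (T (suc d) q)

  j : ℕ → ℕ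
  j p = lvalℕ t (T d p)

  lower-shape : ∀ {q} → 1 ≤ q → q ≤ suc d → XShape t (c q) (T (suc d) q)
  lower-shape 1≤q q≤d+1 =
    IsX⇒XShape (X-row _ 1≤q q≤d+1)
      (ℤₚ.≤-trans (+≤+ z≤n) (proj₁ (within-bounds diagonal d+1<n 1≤q q≤d+1)))

  lower-bounds : ∀ {q} → 1 ≤ q → q ≤ suc d → 1 ≤ c q × c q + t ≤ n
  lower-bounds {q} 1≤q q≤d+1 =
    span-bounds (XShape-lval shape) (XShape-rval shape) (within-bounds diagonal d+1<n 1≤q q≤d+1)
    where
    shape : XShape t (c q) (T (suc d) q)
    shape = lower-shape 1≤q q≤d+1

  upper-shape : ∀ {p} → 1 ≤ p → p ≤ d → VShape t (j p) (T d p)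
  upper-shape 1≤p p≤d = InV⇒VShape (upper-in-V _ 1≤p p≤d)

  upper-bounds : ∀ {p} → 1 ≤ p → p ≤ d → 1 ≤ j p × j p + t ≤ n
  upper-bounds {p} 1≤p p≤d =
    span-bounds (VShape-lval shape) (VShape-rval shape) (within-bounds diagonal d<n 1≤p p≤d)
    where
    shape : VShape t (j p) (T d p)
    shape = upper-shape 1≤p p≤d

  interlacing : ∀ {p} → 1 ≤ p → p ≤ d →
    Interlacing (c p) (j p) (c (suc p)) (T (suc d) p) (T (suc d) (suc p))
  interlacing {p} 1≤p p≤d =
    arrangement⇒Interlacing (lower-shape 1≤p (ℕ.m≤n⇒m≤1+n p≤d)) (upper-shape 1≤p p≤d)
      (lower-shape (s≤s z≤n) (s≤s p≤d))
      (diagonal-below diagonal d+1<n 2≤d+1 1≤p (s≤s p≤d)) (row-below row d+1<n 2≤d+1 1≤p (s≤s p≤d))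
    where
    2≤d+1 : 2 ≤ suc d
    2≤d+1 = s≤s (ℕ.≤-trans 1≤p p≤d)

  lower′-shape : ∀ {q} → 1 ≤ q → q ≤ suc d → VShape t (c q) (T′ (suc d) q)
  lower′-shape {q} 1≤q q≤d+1 =
    subst (VShape t (c q)) (≡-sym (raise-bottom {suc d} {t} {T} {q}))
      (raiseBot-shape {suc d} {t} {T} {q} upper-in-V 1≤q q≤d+1 (lower-shape 1≤q q≤d+1))

  upper′-shape : ∀ {p} → 1 ≤ p → p ≤ d → RaisedShape t (c p) (j p) (c (suc p)) (T′ d p)
  upper′-shape {p} 1≤p p≤d =
    subst (RaisedShape t (c p) (j p) (c (suc p))) (≡-sym (raise-top {d} {t} {T} {p}))
      (raiseTop-shape {suc d} {t} {T} {p} (lower-shape 1≤p (ℕ.m≤n⇒m≤1+n p≤d)) (upper-shape 1≤p p≤d)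
        (lower-shape (s≤s z≤n) (s≤s p≤d)) (interlacing 1≤p p≤d))

  values-preserved : ∀ {r p} → r ≢ d → 1 ≤ p → p ≤ r →
    lval (ρ r) (entry n T r p) ≡ lval (ρ′ r) (entry n T′ r p) ×
    rval (ρ r) (entry n T r p) ≡ rval (ρ′ r) (entry n T′ r p)
  values-preserved {r} {p} r≢d 1≤p p≤r with r ≟ suc d
  ... | yes refl rewrite ρ′-lower | entry-lower {T} {p} | entry-lower {T′} {p} =
    trans (XShape-lval old) (≡-sym (VShape-lval new)) , trans (XShape-rval old) (≡-sym (VShape-rval new))
    where
    old : XShape t (c p) (T (suc d) p)
    old = lower-shape 1≤p p≤r
    new : VShape t (c p) (T′ (suc d) p)
    new = lower′-shape 1≤p p≤r
  ... | no r≢d+1 = cong₂ lval ρ≡ E≡ , cong₂ rval ρ≡ E≡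
    where
    ρ≡ : ρ r ≡ ρ′ r
    ρ≡ = ≡-sym (ρ′-other r≢d)
    E≡ : entry n T r p ≡ entry n T′ r p
    E≡ = entry-other r≢d+1 r≢d

  lower-arrangement : ∀ {p} → 1 ≤ p → p ≤ d →
    DiagonalAt (ρ′ (suc d)) (entry n T′ (suc d) p) (ρ′ d) (entry n T′ d p) (entry n T′ (suc d) (suc p))
  lower-arrangement {p} 1≤p p≤d
    rewrite ρ′-lower | ρ′-upper | entry-lower {T′} {p} | entry-lower {T′} {suc p} | entry-upper {T′} {p} =
    raised-lower-diagonal (lower′-shape 1≤p (ℕ.m≤n⇒m≤1+n p≤d)) (upper′-shape 1≤p p≤d)
      (lower′-shape (s≤s z≤n) (s≤s p≤d))

  upper-arrangement : ∀ {p} → 2 ≤ d → 1 ≤ p → p < d →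
    DiagonalAt (ρ′ d) (entry n T′ d p) (ρ′ (d ∸ 1)) (entry n T′ (d ∸ 1) p) (entry n T′ d (suc p))
  upper-arrangement {p} 2≤d 1≤p p<d =
    DiagonalAt-transport (≡-sym ρ′-upper) (≡-sym (entry-upper {T′})) (≡-sym (entry-upper {T′}))
      (cong₂ lval ρ≡ E≡) (cong₂ rval ρ≡ E≡)
      (raised-upper-diagonal (upper′-shape 1≤p (ℕ.<⇒≤ p<d)) (upper′-shape (s≤s z≤n) p<d)
        (subst (ℤ._≤ lval (ρ (d ∸ 1)) v) (VShape-lval (upper-shape 1≤p (ℕ.<⇒≤ p<d))) (proj₁ old))
        (subst (rval (ρ (d ∸ 1)) v ℤ.≤_) (VShape-rval (upper-shape (s≤s z≤n) p<d)) (proj₁ (proj₂ old))))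
    where
    v : Entry
    v = sym (T (d ∸ 1) p)
    d-1<d : d ∸ 1 < d
    d-1<d = pred-< (ℕ.<⇒≤ 2≤d)
    ρ≡ : ρ (d ∸ 1) ≡ ρ′ (d ∸ 1)
    ρ≡ = ≡-sym (ρ′-other (ℕ.<⇒≢ d-1<d))
    E≡ : v ≡ entry n T′ (d ∸ 1) p
    E≡ = trans (≡-sym (entry-below {T = T} (ℕ.<-trans d-1<d d<n)))
               (entry-other (ℕ.<⇒≢ (ℕ.<-trans d-1<d (ℕ.n<1+n d))) (ℕ.<⇒≢ d-1<d))
    old : DiagonalAt (ρ d) (sym (T d p)) (ρ (d ∸ 1)) v (sym (T d (suc p)))
    old = diagonal-below diagonal d<n 2≤d 1≤p p<d

  diagonal′ : MonotoneDiagonal n T′ ρ′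
  diagonal′ e p 2≤e e≤n 1≤p p<e with e ≟ d
  ... | yes refl = upper-arrangement 2≤e 1≤p p<e
  ... | no e≢d = below-upper e≢d 2≤e e≤n 1≤p p<e
    where
    below-upper : ∀ {e p} → e ≢ d → 2 ≤ e → e ≤ n → 1 ≤ p → p < e →
      DiagonalAt (ρ′ e) (entry n T′ e p) (ρ′ (e ∸ 1)) (entry n T′ (e ∸ 1) p) (entry n T′ e (suc p))
    below-upper {suc e} {p} e+1≢d 2≤e+1 e+1≤n 1≤p (s≤s p≤e) with e ≟ d
    ... | yes refl = lower-arrangement 1≤p p≤e
    ... | no e≢d =
      DiagonalAt-transport (≡-sym (ρ′-other e+1≢d)) E≡ E≡
        (proj₁ (values-preserved e≢d 1≤p p≤e)) (proj₂ (values-preserved e≢d 1≤p p≤e))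
        (diagonal (suc e) p 2≤e+1 e+1≤n 1≤p (s≤s p≤e))
      where
      E≡ : ∀ {q} → entry n T (suc e) q ≡ entry n T′ (suc e) q
      E≡ = entry-other (e≢d ∘ ℕ.suc-injective) e+1≢d

  row′ : MonotoneRow n T′ ρ′
  row′ e p 2≤e e≤n 1≤p p<e with e ≟ suc d | e ≟ d
  ... | yes refl | _ rewrite ρ′-lower | entry-lower {T′} {p} | entry-lower {T′} {suc p} =
    subst₂ ℤ._<_ (≡-sym (VShape-lval (lower′-shape 1≤p (ℕ.<⇒≤ p<e))))
      (≡-sym (VShape-lval (lower′-shape (s≤s z≤n) p<e))) (+<+ (increasing (interlacing 1≤p (s≤s⁻¹ p<e))))
  ... | no _ | yes refl rewrite ρ′-upper | entry-upper {T′} {p} | entry-upper {T′} {suc p} =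
    raised-row (upper′-shape 1≤p (ℕ.<⇒≤ p<e)) (upper′-shape (s≤s z≤n) p<e)
      (ℤₚ.drop‿+<+ (subst₂ ℤ._<_ (VShape-lval (upper-shape 1≤p (ℕ.<⇒≤ p<e)))
        (VShape-lval (upper-shape (s≤s z≤n) p<e)) (row-below row d<n 2≤e 1≤p p<e)))
  ... | no e≢d+1 | no e≢d = subst₂ ℤ._<_ (cong₂ lval ρ≡ E≡) (cong₂ lval ρ≡ E≡) (row e p 2≤e e≤n 1≤p p<e)
    where
    ρ≡ : ρ e ≡ ρ′ e
    ρ≡ = ≡-sym (ρ′-other e≢d)
    E≡ : ∀ {q} → entry n T e q ≡ entry n T′ e q
    E≡ = entry-other e≢d+1 e≢d

  rank-step-other : ∀ {r} → r ≢ suc d → r ≢ d → 1 ≤ r → r < n → RankStep T′ ρ′ r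
  rank-step-other {r} r≢d+1 r≢d 1≤r r<n
    rewrite ρ′-other r≢d | ρ′-other (pred-≢ 1≤r r≢d+1) with rank-step r 1≤r r<n
  ... | inj₁ (isX , eq) =
    inj₁ ((λ p 1≤p p≤r → subst IsX (≡-sym (T′-other r≢d+1 r≢d)) (isX p 1≤p p≤r)) , eq)
  ... | inj₂ (inV , eq) =
    inj₂ ((λ p 1≤p p≤r → subst (InV _) (≡-sym (T′-other r≢d+1 r≢d)) (inV p 1≤p p≤r)) , eq)

  ranked′ : IsRanking n T′ ρ′
  ranked′ = trans (ρ′-other n≢d) (proj₁ ranked) , trans (ρ′-other n-1≢d) (proj₁ (proj₂ ranked)) , step
    where
    n≢d : n ≢ d
    n≢d = ≢-sym (ℕ.<⇒≢ d<n)
    n-1≢d : n ∸ 1 ≢ d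
    n-1≢d = ≢-sym (ℕ.<⇒≢ (ℕ.∸-monoˡ-< {n = 1} d+1<n (s≤s z≤n)))
    step : ∀ r → 1 ≤ r → r < n → RankStep T′ ρ′ r
    step r 1≤r r<n with r ≟ suc d | r ≟ d
    ... | yes refl | _ =
      inj₂ (subst (λ k → RowInV T′ k (suc d)) (≡-sym ρ′-lower)
              (λ q 1≤q q≤d+1 → VShape-InV (lower′-shape 1≤q q≤d+1)) ,
            trans ρ′-upper (cong suc (≡-sym ρ′-lower)))
    ... | no _ | yes refl =
      inj₁ ((λ p 1≤p p≤d → RaisedShape-IsX (upper′-shape 1≤p p≤d)) ,
            trans (ρ′-other (ℕ.<⇒≢ (pred-< 1≤r))) (trans (proj₂ (upper-rank 1≤r)) (≡-sym ρ′-upper)))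
    ... | no r≢d+1 | no r≢d = rank-step-other r≢d+1 r≢d 1≤r r<n

  triangle′ : IsTriangle n T′
  triangle′ r p 1≤r r<n 1≤p p≤r with r ≟ suc d | r ≟ d
  ... | yes refl | _ =
    VShape-valid (rank-positive ranked d+1<n) (lower′-shape 1≤p p≤r) (lower-bounds 1≤p p≤r)
  ... | no _ | yes refl = RaisedShape-valid (upper′-shape 1≤p p≤r) (upper-bounds 1≤p p≤r)
  ... | no r≢d+1 | no r≢d =
    subst (ValidSym n) (≡-sym (T′-other r≢d+1 r≢d)) (triangle r p 1≤r r<n 1≤p p≤r)

  admissible′ : Admissible n T′
  admissible′ = triangle′ , ρ′ , ranked′ , diagonal′ , row′

proposition4 : (n : ℕ) (T : Triangle) (ρ : ℕ → ℕ) (d : ℕ) →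
    IsTriangle n T → AdmissibleWith n T ρ →
    1 ≤ d → d < n → XRow T d → VRow T (d ∸ 1) →
    Admissible n (raise d (ρ d) T)
proposition4 n T ρ (suc d) triangle (ranked , diagonal , row) _ d<n X-row V-row =
  Raise.admissible′ triangle ranked diagonal row d<n X-row V-row
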